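{- Let $E$ be a finite effect algebra with a unique atom $p$. Then every element of $E$ is of the form $kp$ for a unique $k\in\{0,1,\dots,\operatorname{ord}(p)\}$, and hence $E$ is the finite chain $\{0,p,2p,\dots,\operatorname{ord}(p)p=1\}$. In particular, if $\operatorname{ord}(p)\ge 2$, then $E$ admits no (S1)–(S4) operation.
   Context: An effect algebra is $(E,0,1,\oplus)$ with $\oplus$ a partial binary operation that is commutative, associative (in the partial sense), has for each $a$ a unique orthosupplement $a'$ with $a\oplus a'=1$, and satisfies: $a\oplus 1$ defined implies $a=0$. Write $a\perp b$ when $a\oplus b$ is defined; $a\le b$ iff $b=a\oplus c$ for some $c$. An atom is a minimal nonzero element. $na=a\oplus\cdots\oplus a$ ($n$ times) when defined; $\operatorname{ord}(a)=\sup\{n: na\text{ exists}\}$. For a total binary operation $\circ$, $a\mid b$ means $a\circ b=b\circ a$. Axioms: (S1) $b\perp c\Rightarrow a\circ(b\oplus c)=(a\circ b)\oplus(a\circ c)$; (S2) $1\circ a=a$; (S3) $a\circ b=0\Rightarrow a\circ b=b\circ a$; (S4) if $a\mid b$ then $a\mid b'$ and $a\circ(b\circ c)=(a\circ b)\circ c$ for all $c$. An (S1)–(S4) operation is a total binary operation satisfying (S1)–(S4). -}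

module Defs where

open import Data.Nat using (ℕ; zero; suc; _≤_)
open import Data.Fin using (Fin)
open import Data.Maybe using (Maybe; just; nothing; _>>=_)
open import Data.Product using (Σ; ∃; _×_; _,_; proj₁)
open import Data.Empty using (⊥)
open import Relation.Nullary using (¬_)
open import Relation.Binary.PropositionalEquality using (_≡_; _≢_)
open import Function.Bundles using (_↔_)

-- Effect algebra (E,0,1,⊕); the partial operation ⊕ is a total function into Maybe,
-- with 'nothing' meaning "undefined".
record EffectAlgebra : Set₁ where
  field
    Carrier : Set
    𝟘 𝟙 : Carrier
    _⊕_ : Carrier → Carrier → Maybe Carrier
    ⊕-comm : ∀ a b → a ⊕ b ≡ b ⊕ a
    ⊕-assoc : ∀ a b c d e → a ⊕ b ≡ just d → d ⊕ c ≡ just e →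
              Σ Carrier λ f → (b ⊕ c ≡ just f) × (a ⊕ f ≡ just e)
    ortho : ∀ a → Σ Carrier λ a' → (a ⊕ a' ≡ just 𝟙) ×
                                  (∀ b → a ⊕ b ≡ just 𝟙 → b ≡ a')
    zero-one : ∀ a x → a ⊕ 𝟙 ≡ just x → a ≡ 𝟘
    ⊕-identityˡ : ∀ a → 𝟘 ⊕ a ≡ just a

module EA (E : EffectAlgebra) where
  open EffectAlgebra E

  _′ : Carrier → Carrier
  a ′ = proj₁ (ortho a)

  _⊥E_ : Carrier → Carrier → Set
  a ⊥E b = Σ Carrier λ c → a ⊕ b ≡ just c

  _≤E_ : Carrier → Carrier → Set
  a ≤E b = Σ Carrier λ c → a ⊕ c ≡ just b

  IsAtom : Carrier → Set
  IsAtom a = (a ≢ 𝟘) × (∀ b → b ≢ 𝟘 → b ≤E a → b ≡ a)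

  UniqueAtom : Carrier → Set
  UniqueAtom p = IsAtom p × (∀ q → IsAtom q → q ≡ p)

  mul : ℕ → Carrier → Maybe Carrier
  mul zero a = just 𝟘
  mul (suc n) a = mul n a >>= λ x → x ⊕ a

  -- ord(a) = N (finite): N·a exists and (N+1)·a does not
  -- (hence n·a exists exactly for n ≤ N)
  HasOrd : Carrier → ℕ → Set
  HasOrd a N = (Σ Carrier λ x → mul N a ≡ just x) × (mul (suc N) a ≡ nothing)

  record SOp (_∘_ : Carrier → Carrier → Carrier) : Set where
    field
      S1 : ∀ a b c d → b ⊕ c ≡ just d → (a ∘ b) ⊕ (a ∘ c) ≡ just (a ∘ d)
      S2 : ∀ a → 𝟙 ∘ a ≡ a
      S3 : ∀ a b → a ∘ b ≡ 𝟘 → a ∘ b ≡ b ∘ a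
      S4 : ∀ a b → a ∘ b ≡ b ∘ a →
           (a ∘ (b ′) ≡ (b ′) ∘ a) × (∀ c → a ∘ (b ∘ c) ≡ (a ∘ b) ∘ c)

  AdmitsSOp : Set
  AdmitsSOp = Σ (Carrier → Carrier → Carrier) SOp

Finite : EffectAlgebra → Set
Finite E = Σ ℕ λ n → Fin n ↔ EffectAlgebra.Carrier E

-- Below a nonzero element of a finite effect algebra there is always an atom, so if p is
-- the only atom then p ≤ x for every x ≠ 0. Peeling off copies of p and using that the
-- strict order is well founded writes every x as k·p; the multiples k·p strictly increase,
-- so k is unique, and since the order is also Noetherian the chain 0 < p < 2p < ⋯ stops at
-- some N = ord(p) with N·p = 1. Given an (S1)–(S4) operation ∘, the map x ↦ p ∘ x preserves
-- ⊕ and sends 1 to p, so r = p ∘ p satisfies N·r = p. For N ≥ 2 this gives r ≤ 2r ≤ p,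
-- hence r = p (r = 0 would force p = N·0 = 0) and then p ⊕ p ≤ p, i.e. p = 0.
module Submission where

open import Defs
open import Data.Nat using (ℕ; zero; suc; _≤_; _<_; _≤′_; ≤′-refl; ≤′-step; _≤?_)
open import Data.Nat.Properties using (≤⇒≤′; ≰⇒>; <-cmp)
open import Data.Fin.Properties using (any?; inj⇒≟)
open import Data.Fin.Induction using (po-wellFounded; po-noetherian)
open import Data.Maybe using (just; nothing)
open import Data.Maybe.Properties using (just-injective) renaming (≡-dec to ≡-decMaybe)
open import Data.Product using (Σ; _×_; _,_; proj₁; proj₂)
open import Data.Empty using (⊥-elim)
open import Function using (flip; _on_)
open import Function.Bundles using (Inverse)
open import Function.Properties.Inverse using (↔-sym; ↔⇒↣)
open import Induction.WellFounded using (WellFounded; Acc; acc; module Subrelation)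
open import Level using (Level)
open import Relation.Binary.Core using (Rel)
open import Relation.Binary.Definitions using (DecidableEquality; tri<; tri≈; tri>)
open import Relation.Binary.Structures using (IsPartialOrder)
import Relation.Binary.Construct.On as On
open import Relation.Nullary using (¬_; Dec; yes; no)
open import Relation.Nullary.Decidable using (map′; ¬?; _×-dec_; decidable-stable)
open import Relation.Binary.PropositionalEquality

module EffectAlgebraProperties (E : EffectAlgebra) where
  open EffectAlgebra E
  open EA E

  private variable
    a b b₁ b₂ c p x y z : Carrier
    j k N : ℕ

  ⊕-identityʳ : ∀ a → a ⊕ 𝟘 ≡ just a
  ⊕-identityʳ a = trans (⊕-comm a 𝟘) (⊕-identityˡ a)

  ⊕-′ : ∀ a → a ⊕ (a ′) ≡ just 𝟙
  ⊕-′ a = proj₁ (proj₂ (ortho a))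

  ′-unique : a ⊕ b ≡ just 𝟙 → b ≡ (a ′)
  ′-unique {a} {b} = proj₂ (proj₂ (ortho a)) b

  𝟘′≡𝟙 : 𝟘 ′ ≡ 𝟙
  𝟘′≡𝟙 = just-injective (trans (sym (⊕-identityˡ (𝟘 ′))) (⊕-′ 𝟘))

  -- Both b₁ and b₂ are the orthosupplement of a ⊕ c′.
  ⊕-cancelˡ : a ⊕ b₁ ≡ just c → a ⊕ b₂ ≡ just c → b₁ ≡ b₂
  ⊕-cancelˡ {a} {b₁} {c} {b₂} a⊕b₁≡c a⊕b₂≡c =
    let f , a⊕c′≡f , b₁⊕f≡𝟙 = ⊕-assoc b₁ a (c ′) c 𝟙 (trans (⊕-comm b₁ a) a⊕b₁≡c) (⊕-′ c)
        g , a⊕c′≡g , b₂⊕g≡𝟙 = ⊕-assoc b₂ a (c ′) c 𝟙 (trans (⊕-comm b₂ a) a⊕b₂≡c) (⊕-′ c)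
        open ≡-Reasoning
    in begin
      b₁   ≡⟨ ′-unique (trans (⊕-comm f b₁) b₁⊕f≡𝟙) ⟩
      f ′  ≡⟨ cong _′ (just-injective (trans (sym a⊕c′≡f) a⊕c′≡g)) ⟩
      g ′  ≡⟨ sym (′-unique (trans (⊕-comm g b₂) b₂⊕g≡𝟙)) ⟩
      b₂   ∎

  a⊕b≡a⇒b≡𝟘 : a ⊕ b ≡ just a → b ≡ 𝟘
  a⊕b≡a⇒b≡𝟘 {a} a⊕b≡a = ⊕-cancelˡ a⊕b≡a (⊕-identityʳ a)

  ⊕-positiveˡ : a ⊕ b ≡ just 𝟘 → a ≡ 𝟘
  ⊕-positiveˡ {a} {b} a⊕b≡𝟘 =
    let f , b⊕𝟙≡f , _ = ⊕-assoc a b 𝟙 𝟘 𝟙 a⊕b≡𝟘 (⊕-identityˡ 𝟙)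
        b≡𝟘 = zero-one b f b⊕𝟙≡f
    in just-injective (trans (sym (⊕-identityʳ a)) (subst (λ b → a ⊕ b ≡ just 𝟘) b≡𝟘 a⊕b≡𝟘))

  ≤E-refl : a ≤E a
  ≤E-refl {a} = 𝟘 , ⊕-identityʳ a

  ≤E-trans : a ≤E b → b ≤E c → a ≤E c
  ≤E-trans {a} {b} {c} (d , a⊕d≡b) (e , b⊕e≡c) =
    let f , _ , a⊕f≡c = ⊕-assoc a d e b c a⊕d≡b b⊕e≡c in f , a⊕f≡c

  ≤E-antisym : a ≤E b → b ≤E a → a ≡ b
  ≤E-antisym {a} {b} (d , a⊕d≡b) (e , b⊕e≡a) =
    let f , d⊕e≡f , a⊕f≡a = ⊕-assoc a d e b a a⊕d≡b b⊕e≡a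
        d≡𝟘 = ⊕-positiveˡ (subst (λ f → d ⊕ e ≡ just f) (a⊕b≡a⇒b≡𝟘 a⊕f≡a) d⊕e≡f)
    in just-injective (trans (sym (⊕-identityʳ a)) (subst (λ d → a ⊕ d ≡ just b) d≡𝟘 a⊕d≡b))

  ≤E-isPartialOrder : IsPartialOrder _≡_ _≤E_
  ≤E-isPartialOrder = record
    { isPreorder = record
      { isEquivalence = isEquivalence
      ; reflexive     = λ { refl → ≤E-refl }
      ; trans         = ≤E-trans
      }
    ; antisym    = ≤E-antisym
    }

  ≤E-𝟙 : ∀ a → a ≤E 𝟙
  ≤E-𝟙 a = a ′ , ⊕-′ a

  a⊕b≤a⇒b≡𝟘 : a ⊕ b ≡ just c → c ≤E a → b ≡ 𝟘
  a⊕b≤a⇒b≡𝟘 {a} {b} a⊕b≡c c≤a =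
    a⊕b≡a⇒b≡𝟘 (subst (λ c → a ⊕ b ≡ just c) (≤E-antisym c≤a (b , a⊕b≡c)) a⊕b≡c)

  _<E_ : Rel Carrier _
  a <E b = a ≤E b × a ≢ b

  ⊕-<E : b ≢ 𝟘 → a ⊕ b ≡ just c → a <E c
  ⊕-<E b≢𝟘 a⊕b≡c = (_ , a⊕b≡c) , λ { refl → b≢𝟘 (a⊕b≡a⇒b≡𝟘 a⊕b≡c) }

  mul-suc-just : ∀ k a → mul k a ≡ just x → mul (suc k) a ≡ x ⊕ a
  mul-suc-just k a ka≡x rewrite ka≡x = refl

  mul-suc-inv : ∀ k a → mul (suc k) a ≡ just z → Σ Carrier λ y → mul k a ≡ just y × y ⊕ a ≡ just z
  mul-suc-inv k a sk·a≡z with mul k a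
  ... | just y = y , refl , sk·a≡z

  mul-two : ∀ a → mul 2 a ≡ a ⊕ a
  mul-two a = mul-suc-just 1 a (⊕-identityˡ a)

  mul-zero : ∀ k → mul k 𝟘 ≡ just 𝟘
  mul-zero zero    = refl
  mul-zero (suc k) = trans (mul-suc-just k 𝟘 (mul-zero k)) (⊕-identityˡ 𝟘)

  mul-mono : ∀ a → j ≤ k → mul k a ≡ just z → Σ Carrier λ y → mul j a ≡ just y × y ≤E z
  mul-mono a j≤k = go (≤⇒≤′ j≤k)
    where
    go : j ≤′ k → mul k a ≡ just z → Σ Carrier λ y → mul j a ≡ just y × y ≤E z
    go ≤′-refl ka≡z = _ , ka≡z , ≤E-refl
    go {k = suc k} (≤′-step j≤k) sk·a≡z =
      let x , ka≡x , x⊕a≡z = mul-suc-inv k a sk·a≡z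
          y , ja≡y , y≤x = go j≤k ka≡x
      in y , ja≡y , ≤E-trans y≤x (_ , x⊕a≡z)

  mul-<-≢ : a ≢ 𝟘 → j < k → mul j a ≡ just x → mul k a ≢ just x
  mul-<-≢ {a} {j} a≢𝟘 j<k ja≡x ka≡x =
    let y , sj·a≡y , y≤x = mul-mono a j<k ka≡x
        x<y = ⊕-<E a≢𝟘 (trans (sym (mul-suc-just j a ja≡x)) sj·a≡y)
    in proj₂ x<y (≤E-antisym (proj₁ x<y) y≤x)

  mul-injective : a ≢ 𝟘 → mul j a ≡ just x → mul k a ≡ just x → j ≡ k
  mul-injective {j = j} {k = k} a≢𝟘 ja≡x ka≡x with <-cmp j k
  ... | tri< j<k _ _ = ⊥-elim (mul-<-≢ a≢𝟘 j<k ja≡x ka≡x)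
  ... | tri≈ _ j≡k _ = j≡k
  ... | tri> _ _ k<j = ⊥-elim (mul-<-≢ a≢𝟘 k<j ka≡x ja≡x)

  hasOrd-bound : HasOrd a N → mul k a ≡ just z → k ≤ N
  hasOrd-bound {a} {N} {k} (_ , sN·a≡nothing) ka≡z with k ≤? N
  ... | yes k≤N = k≤N
  ... | no k≰N with mul-mono a (≰⇒> k≰N) ka≡z
  ...   | _ , sN·a≡y , _ with () ← trans (sym sN·a≡nothing) sN·a≡y

  hasOrd-top : HasOrd a N → Σ ℕ (λ k → mul k a ≡ just 𝟙) → mul N a ≡ just 𝟙
  hasOrd-top {a} {N} ord@((x , Na≡x) , _) (k , ka≡𝟙) =
    let y , ka≡y , y≤x = mul-mono a (hasOrd-bound {N = N} {k = k} ord ka≡𝟙) Na≡x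
        𝟙≤x = subst (_≤E x) (just-injective (trans (sym ka≡y) ka≡𝟙)) y≤x
    in trans Na≡x (cong just (≤E-antisym (≤E-𝟙 x) 𝟙≤x))

  module _ {_∘_ : Carrier → Carrier → Carrier} (S : SOp _∘_) where
    open SOp S

    ∘-zeroʳ : ∀ a → a ∘ 𝟘 ≡ 𝟘
    ∘-zeroʳ a = a⊕b≡a⇒b≡𝟘 (S1 a 𝟘 𝟘 𝟘 (⊕-identityˡ 𝟘))

    -- a commutes with 𝟘 by (S3), hence with 𝟘 ′ = 𝟙 by (S4).
    ∘-identityʳ : ∀ a → a ∘ 𝟙 ≡ a
    ∘-identityʳ a =
      trans (subst (λ u → a ∘ u ≡ u ∘ a) 𝟘′≡𝟙 (proj₁ (S4 a 𝟘 (S3 a 𝟘 (∘-zeroʳ a))))) (S2 a)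

    ∘-mul : ∀ a {b} k → mul k b ≡ just y → mul k (a ∘ b) ≡ just (a ∘ y)
    ∘-mul a zero    refl = cong just (sym (∘-zeroʳ a))
    ∘-mul a {b} (suc k) sk·b≡y =
      let x , kb≡x , x⊕b≡y = mul-suc-inv k b sk·b≡y
      in trans (mul-suc-just k (a ∘ b) (∘-mul a k kb≡x)) (S1 a x b _ x⊕b≡y)

  ¬AdmitsSOp : IsAtom p → 2 ≤ N → mul N p ≡ just 𝟙 → ¬ AdmitsSOp
  ¬AdmitsSOp {p} {N} (p≢𝟘 , p-minimal) 2≤N Np≡𝟙 (_∘_ , S) =
    let w , 2r≡w , w≤p = mul-mono r 2≤N Nr≡p
        r⊕r≡w = trans (sym (mul-two r)) 2r≡w
        r≡p = p-minimal r r≢𝟘 (≤E-trans (r , r⊕r≡w) w≤p)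
    in p≢𝟘 (a⊕b≤a⇒b≡𝟘 (subst (λ x → x ⊕ x ≡ just w) r≡p r⊕r≡w) w≤p)
    where
    r : Carrier
    r = p ∘ p
    Nr≡p : mul N r ≡ just p
    Nr≡p = trans (∘-mul S p N Np≡𝟙) (cong just (∘-identityʳ S p))
    r≢𝟘 : r ≢ 𝟘
    r≢𝟘 r≡𝟘 = p≢𝟘 (just-injective (trans (sym Nr≡p) (trans (cong (mul N) r≡𝟘) (mul-zero N))))

  module _ (fin : Finite E) where
    open Inverse (proj₂ fin) using (to; from) renaming (strictlyInverseˡ to to∘from)

    _≟_ : DecidableEquality Carrier
    _≟_ = inj⇒≟ (↔⇒↣ (↔-sym (proj₂ fin)))

    ∃? : {P : Carrier → Set} → (∀ x → Dec (P x)) → Dec (Σ Carrier P)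
    ∃? {P} P? = map′ (λ (i , Pi) → to i , Pi)
                     (λ (x , Px) → from x , subst P (sym (to∘from x)) Px)
                     (any? (λ i → P? (to i)))

    ≤E? : ∀ a b → Dec (a ≤E b)
    ≤E? a b = ∃? (λ c → ≡-decMaybe _≟_ (a ⊕ c) (just b))

    wellFounded-via-Fin : {ℓ : Level} {R : Rel Carrier ℓ} → WellFounded (R on to) → WellFounded R
    wellFounded-via-Fin {R = R} wf =
      Subrelation.wellFounded (λ {x} {y} → subst₂ R (sym (to∘from x)) (sym (to∘from y)))
                              (On.wellFounded from wf)

    <E-wellFounded : WellFounded _<E_
    <E-wellFounded = wellFounded-via-Fin (po-wellFounded (On.isPartialOrder to ≤E-isPartialOrder))

    >E-wellFounded : WellFounded (flip _<E_)
    >E-wellFounded = wellFounded-via-Fin (po-noetherian (On.isPartialOrder to ≤E-isPartialOrder))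

    atom-below : a ≢ 𝟘 → Σ Carrier λ q → IsAtom q × q ≤E a
    atom-below {a} = go a (<E-wellFounded a)
      where
      go : ∀ a → Acc _<E_ a → a ≢ 𝟘 → Σ Carrier λ q → IsAtom q × q ≤E a
      go a (acc rec) a≢𝟘 with ∃? (λ b → ¬? (b ≟ 𝟘) ×-dec ≤E? b a ×-dec ¬? (b ≟ a))
      ... | yes (b , b≢𝟘 , b<a) =
        let q , q-atom , q≤b = go b (rec b<a) b≢𝟘 in q , q-atom , ≤E-trans q≤b (proj₁ b<a)
      ... | no ∄b = a , (a≢𝟘 , minimal) , ≤E-refl
        where
        minimal : ∀ b → b ≢ 𝟘 → b ≤E a → b ≡ a
        minimal b b≢𝟘 b≤a = decidable-stable (b ≟ a) (λ b≢a → ∄b (b , b≢𝟘 , b≤a , b≢a))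

    hasOrd-exists : a ≢ 𝟘 → Σ ℕ (HasOrd a)
    hasOrd-exists {a} a≢𝟘 = go 0 𝟘 refl (>E-wellFounded 𝟘)
      where
      go : ∀ k x → mul k a ≡ just x → Acc (flip _<E_) x → Σ ℕ (HasOrd a)
      go k x ka≡x (acc rec) with x ⊕ a in x⊕a≡
      ... | nothing = k , (x , ka≡x) , trans (mul-suc-just k a ka≡x) x⊕a≡
      ... | just y  = go (suc k) y (trans (mul-suc-just k a ka≡x) x⊕a≡) (rec (⊕-<E a≢𝟘 x⊕a≡))

    module _ (p-unique : UniqueAtom p) where

      uniqueAtom-≤E : a ≢ 𝟘 → p ≤E a
      uniqueAtom-≤E {a} a≢𝟘 =
        let q , q-atom , q≤a = atom-below a≢𝟘 in subst (_≤E a) (proj₂ p-unique q q-atom) q≤a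

      multiple-of-uniqueAtom : ∀ x → Σ ℕ λ k → mul k p ≡ just x
      multiple-of-uniqueAtom x = go x (<E-wellFounded x)
        where
        go : ∀ x → Acc _<E_ x → Σ ℕ λ k → mul k p ≡ just x
        go x (acc rec) with x ≟ 𝟘
        ... | yes refl = 0 , refl
        ... | no x≢𝟘 =
          let c , p⊕c≡x = uniqueAtom-≤E x≢𝟘
              c⊕p≡x = trans (⊕-comm c p) p⊕c≡x
              k , kp≡c = go c (rec (⊕-<E (proj₁ (proj₁ p-unique)) c⊕p≡x))
          in suc k , trans (mul-suc-just k p kp≡c) c⊕p≡x

proposition4p3 : (E : EffectAlgebra) → Finite E →
    (p : EffectAlgebra.Carrier E) → EA.UniqueAtom E p →
    Σ ℕ λ N → EA.HasOrd E p N
      × (∀ x → Σ ℕ λ k → (k ≤ N) × (EA.mul E k p ≡ just x)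
                × (∀ j → j ≤ N → EA.mul E j p ≡ just x → j ≡ k))
      × (EA.mul E N p ≡ just (EffectAlgebra.𝟙 E))
      × (2 ≤ N → ¬ EA.AdmitsSOp E)
proposition4p3 E fin p p-unique@(p-atom@(p≢𝟘 , _) , _) =
  N , ord , unique-multiple , Np≡𝟙 , λ 2≤N → ¬AdmitsSOp p-atom 2≤N Np≡𝟙
  where
  open EffectAlgebra E
  open EA E
  open EffectAlgebraProperties E

  N : ℕ
  N = proj₁ (hasOrd-exists fin p≢𝟘)

  ord : HasOrd p N
  ord = proj₂ (hasOrd-exists fin p≢𝟘)

  unique-multiple : ∀ x → Σ ℕ λ k → (k ≤ N) × (mul k p ≡ just x)
                      × (∀ j → j ≤ N → mul j p ≡ just x → j ≡ k)
  unique-multiple x =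
    let k , kp≡x = multiple-of-uniqueAtom fin p-unique x
    in k , hasOrd-bound {N = N} ord kp≡x , kp≡x , λ j _ jp≡x → mul-injective p≢𝟘 jp≡x kp≡x

  Np≡𝟙 : mul N p ≡ just 𝟙
  Np≡𝟙 = hasOrd-top {N = N} ord (multiple-of-uniqueAtom fin p-unique 𝟙)
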